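{- For all integers $n$ and $d$ with $3\leq d<\left\lceil\frac{n}{2}\right\rceil$, $$t(n,d)\leq n-2+\left\lceil\frac{n}{d-1}\right\rceil.$$
   Context: All graphs are finite, simple and undirected. An edge-coloring of a graph (adjacent edges may receive the same color) is a $k$-rainbow connected coloring if it uses colors from a set of $k$ colors and every two distinct vertices are joined by a rainbow path, i.e. a path no two of whose edges have the same color. A graph is $d$-rainbow connected if it admits a $d$-rainbow connected coloring. For integers $n$ and $d$, $t(n,d)$ denotes the minimum number of edges of a $d$-rainbow connected graph of order $n$. -}

module Defs where

open import Data.Nat using (ℕ; zero; suc; _+_; _∸_; _<ᵇ_)
open import Data.Nat.DivMod using (_/_)
open import Data.Fin using (Fin; toℕ)
open import Data.Bool using (Bool; true; false; _∧_; if_then_else_)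
open import Data.List using (List; []; _∷_; map; allFin)
open import Data.Nat.ListAction using (sum)
open import Data.List.Relation.Unary.Unique.Propositional using (Unique)
open import Data.Product using (Σ; _×_; ∃; ∃-syntax)
open import Relation.Binary.PropositionalEquality using (_≡_; _≢_)

record Graph (n : ℕ) : Set where
  field
    adj    : Fin n → Fin n → Bool
    sym    : ∀ i j → adj i j ≡ adj j i
    irrefl : ∀ i → adj i i ≡ false
open Graph public

numEdges : {n : ℕ} → Graph n → ℕ
numEdges {n} G =
  sum (map (λ i → sum (map (λ j → if adj G i j ∧ (toℕ i <ᵇ toℕ j) then 1 else 0)
                           (allFin n)))
           (allFin n))

-- An edge-colouring with colours from Fin k: the colour of edge {i,j}
-- is c i j (= c j i); values on non-edges are irrelevant.
EdgeColoring : ℕ → ℕ → Set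
EdgeColoring n k = Fin n → Fin n → Fin k

IsSymmetric : {n k : ℕ} → EdgeColoring n k → Set
IsSymmetric c = ∀ i j → c i j ≡ c j i

data Walk {n k : ℕ} (G : Graph n) (c : EdgeColoring n k)
          : Fin n → Fin n → List (Fin n) → List (Fin k) → Set where
  here : ∀ {u} → Walk G c u u (u ∷ []) []
  step : ∀ {u w v vs cs} → adj G u w ≡ true → Walk G c w v vs cs →
         Walk G c u v (u ∷ vs) (c u w ∷ cs)

RainbowPath : {n k : ℕ} → Graph n → EdgeColoring n k → Fin n → Fin n → Set
RainbowPath G c u v =
  ∃[ vs ] ∃[ cs ] (Walk G c u v vs cs × Unique vs × Unique cs)

IsRainbowConnectedColoring : {n k : ℕ} → Graph n → EdgeColoring n k → Set
IsRainbowConnectedColoring G c =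
  IsSymmetric c × (∀ u v → u ≢ v → RainbowPath G c u v)

RainbowConnected : {n : ℕ} → Graph n → ℕ → Set
RainbowConnected {n} G k = ∃[ c ] IsRainbowConnectedColoring {n} {k} G c

-- ceiling division ⌈m / k⌉ (junk value 0 for k = 0)
ceilDiv : ℕ → ℕ → ℕ
ceilDiv m zero    = 0
ceilDiv m (suc k) = (m + k) / suc k

module Submission where

-- Put m = d − 1 and divide: n − 1 = q m + r with r < m; the hypothesis on d forces
-- q ≥ 1.  The witness is a bouquet of q cycles of length d through a common vertex,
-- the hub, with r pendant vertices attached to the hub; it has q d + r edges, which is
-- exactly n − 2 + ⌈n / m⌉.  Around every cycle the edges are coloured 0, 1, …, m in
-- order, and the t-th pendant edge gets colour t.  From the i-th vertex of a cycle the
-- hub is reached rainbowly going down the cycle (colours < i) or going up (colours ≥ i),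
-- and any two vertices are joined by gluing at the hub two such routes whose colour sets
-- are disjoint.

open import Defs hiding (sym)
open import Data.Nat using (ℕ; _+_; _∸_; _≤_; _<_; ⌈_/2⌉)
open import Data.Product using (Σ; _×_)
open import Data.Nat using (zero; suc; _*_; z≤n; s≤s; z<s; _<ᵇ_; _≡ᵇ_; _⊓_; _⊔_; NonZero; >-nonZero; >-nonZero⁻¹)
open import Data.Nat.Properties
open import Data.Nat.DivMod using (_/_; _%_; _mod_; m<n⇒m/n≡0; m*n/n≡m; +-distrib-/; m<n⇒m%n≡m; m*n%n≡0; [m+kn]%n≡m%n; m%n<n; m≡m%n+[m/n]*n; m<n*o⇒m/o<n; m≥n⇒m/n>0)
open import Data.Nat.ListAction using (sum)
open import Data.Fin using (Fin; toℕ)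
open import Data.Fin.Properties using (toℕ-fromℕ<; toℕ-injective; toℕ<n)
open import Data.Bool using (Bool; true; false; T; _∧_; _∨_; not; if_then_else_)
open import Data.Bool.Properties using (∨-comm; ∨-zeroʳ)
open import Data.List using (List; []; _∷_; _++_; _∷ʳ_; reverse; applyDownFrom; map; allFin; tabulate)
open import Data.List.Properties using (unfold-reverse; reverse-++; map-tabulate)
open import Data.List.Relation.Unary.All as All using (All; []; _∷_)
import Data.List.Relation.Unary.All.Properties as All
open import Data.List.Relation.Unary.AllPairs using ([]; _∷_)
open import Data.List.Relation.Unary.Unique.Propositional using (Unique)
import Data.List.Relation.Unary.Unique.Propositional.Properties as Unique
open import Data.List.Relation.Binary.Disjoint.Propositional using (Disjoint)
open import Data.List.Relation.Binary.Permutation.Propositional using (↭-sym)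
open import Data.List.Relation.Binary.Permutation.Propositional.Properties using (All-resp-↭; ↭-reverse)
open import Data.Product using (_,_; proj₁; proj₂; ∃-syntax)
open import Data.Sum using (_⊎_; inj₁; inj₂)
open import Data.Empty using (⊥; ⊥-elim)
open import Function using (id; _∘_)
open import Relation.Nullary using (yes; no)
open import Relation.Binary.PropositionalEquality
open import Algebra.Properties.CommutativeSemigroup +-commutativeSemigroup using (interchange)

toℕ-mod : ∀ {z k} .{{_ : NonZero k}} → z < k → toℕ (z mod k) ≡ z
toℕ-mod {z} {k} z<k = trans (toℕ-fromℕ< _) (m<n⇒m%n≡m z<k)

<ᵇ-true : ∀ {x y} → x < y → (x <ᵇ y) ≡ true
<ᵇ-true {zero}  {suc y} _       = refl
<ᵇ-true {suc x} {suc y} (s≤s h) = <ᵇ-true h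

<ᵇ-false : ∀ {x y} → y ≤ x → (x <ᵇ y) ≡ false
<ᵇ-false {x}     {zero}  _       = refl
<ᵇ-false {suc x} {suc y} (s≤s h) = <ᵇ-false h

≡ᵇ-refl : ∀ x → (x ≡ᵇ x) ≡ true
≡ᵇ-refl zero    = refl
≡ᵇ-refl (suc x) = ≡ᵇ-refl x

div-digits : ∀ {b p q} .{{_ : NonZero q}} → b < q → (b + p * q) / q ≡ p
div-digits {b} {p} {q} b<q = begin
  (b + p * q) / q       ≡⟨ +-distrib-/ b (p * q) remainders<q ⟩
  b / q + p * q / q     ≡⟨ cong₂ _+_ (m<n⇒m/n≡0 b<q) (m*n/n≡m p q) ⟩
  p                     ∎
  where
  open ≡-Reasoning
  remainders<q : b % q + p * q % q < q
  remainders<q = subst (_< q)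
    (sym (trans (cong₂ _+_ (m<n⇒m%n≡m b<q) (m*n%n≡0 p q)) (+-identityʳ b))) b<q

mod-digits : ∀ {b p q} .{{_ : NonZero q}} → b < q → (b + p * q) % q ≡ b
mod-digits {b} {p} {q} b<q = trans ([m+kn]%n≡m%n b p q) (m<n⇒m%n≡m b<q)

digits-injective : ∀ {b b′ p p′ q} .{{_ : NonZero q}} → b < q → b′ < q →
                   b + p * q ≡ b′ + p′ * q → p ≡ p′ × b ≡ b′
digits-injective {b} {b′} {p} {p′} {q} b<q b′<q eq =
  trans (sym (div-digits {p = p} b<q)) (trans (cong (_/ q) eq) (div-digits b′<q)) ,
  trans (sym (mod-digits {p = p} b<q)) (trans (cong (_% q) eq) (mod-digits {p = p′} b′<q))

disjoint-by : {A : Set} {P Q : A → Set} {xs ys : List A} →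
              All P xs → All Q ys → (∀ {z} → P z → Q z → ⊥) → Disjoint xs ys
disjoint-by px qy excl (z∈xs , z∈ys) = excl (All.lookup px z∈xs) (All.lookup qy z∈ys)

all-reverse : {A : Set} {P : A → Set} {xs : List A} → All P xs → All P (reverse xs)
all-reverse {xs = xs} = All-resp-↭ (↭-sym (↭-reverse xs))

unique-reverse : {A : Set} {xs : List A} → Unique xs → Unique (reverse xs)
unique-reverse [] = []
unique-reverse {xs = x ∷ xs} (x∉xs ∷ u) =
  subst Unique (sym (unfold-reverse x xs))
    (Unique.++⁺ (unique-reverse u) ([] ∷ [])
      (disjoint-by (all-reverse x∉xs) (refl ∷ []) (λ x≢z z≡x → x≢z (sym z≡x))))

module _ {n k : ℕ} {G : Graph n} {c : EdgeColoring n k} where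

  snoc-walk : ∀ {u w v vs cs} → Walk G c u w vs cs → adj G w v ≡ true →
              Walk G c u v (vs ∷ʳ v) (cs ∷ʳ c w v)
  snoc-walk here        e = step e here
  snoc-walk (step e′ W) e = step e′ (snoc-walk W e)

  reverse-walk : IsSymmetric c → ∀ {u v vs cs} → Walk G c u v vs cs →
                 Walk G c v u (reverse vs) (reverse cs)
  reverse-walk s here = here
  reverse-walk s {vs = u ∷ vs} {cs = _ ∷ cs} (step {w = w} e W) =
    subst₂ (Walk G c _ u)
      (sym (unfold-reverse u vs))
      (trans (cong (reverse cs ∷ʳ_) (s w u)) (sym (unfold-reverse _ cs)))
      (snoc-walk (reverse-walk s W) (trans (Graph.sym G w u) e))

  append-walk : ∀ {u w v ws cs ds} xs → Walk G c u w (xs ∷ʳ w) cs → Walk G c w v ws ds →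
                Walk G c u v (xs ++ ws) (cs ++ ds)
  append-walk []           here                W′ = W′
  append-walk []           (step _ ())         W′
  append-walk (_ ∷ [])     (step e here)       W′ = step e W′
  append-walk (_ ∷ [])     (step _ (step _ ())) W′
  append-walk (_ ∷ y ∷ xs) (step e W)          W′ = step e (append-walk (y ∷ xs) W W′)

  reverse-path : IsSymmetric c → ∀ {u v} → RainbowPath G c u v → RainbowPath G c v u
  reverse-path s (vs , cs , W , uvs , ucs) =
    reverse vs , reverse cs , reverse-walk s W , unique-reverse uvs , unique-reverse ucs

  ColouredEdge : Fin n → Fin n → ℕ → Set
  ColouredEdge u v j = adj G u v ≡ true × toℕ (c u v) ≡ j

  flip-edge : IsSymmetric c → ∀ {u v j} → ColouredEdge u v j → ColouredEdge v u j
  flip-edge s {u} {v} (e , col) = trans (Graph.sym G v u) e , trans (cong toℕ (s v u)) col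

  record Route (h x : Fin n) (Pv : Fin n → Set) (Pc : Fin k → Set) : Set where
    field
      vertices       : List (Fin n)
      colours        : List (Fin k)
      walk           : Walk G c x h (vertices ∷ʳ h) colours
      vertices-fresh : Unique vertices
      colours-fresh  : Unique colours
      avoid-hub      : All (_≢ h) vertices
      vertices-in    : All Pv vertices
      colours-in     : All Pc colours
  open Route

  route-path : ∀ {h x Pv Pc} → Route h x Pv Pc → RainbowPath G c x h
  route-path R = _ , _ , walk R ,
    Unique.++⁺ (vertices-fresh R) ([] ∷ [])
      (disjoint-by (avoid-hub R) (refl ∷ []) (λ z≢h z≡h → z≢h z≡h)) ,
    colours-fresh R

  glue : IsSymmetric c → ∀ {h x y Pv Pc Pv′ Pc′} → Route h x Pv Pc → Route h y Pv′ Pc′ →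
         (∀ {z} → Pv z → Pv′ z → ⊥) → (∀ {a} → Pc a → Pc′ a → ⊥) → RainbowPath G c x y
  glue s {h} {y = y} {Pv = Pv} {Pv′ = Pv′} Rx Ry vDisj cDisj =
    _ , _ , append-walk (vertices Rx) (walk Rx) outWalk ,
    Unique.++⁺ (vertices-fresh Rx)
      (All.map (λ z≢h h≡z → z≢h (sym h≡z)) (all-reverse (avoid-hub Ry))
        ∷ unique-reverse (vertices-fresh Ry))
      (disjoint-by (All.zip (avoid-hub Rx , vertices-in Rx))
                   (inj₁ refl ∷ all-reverse (All.map inj₂ (vertices-in Ry))) vExcl) ,
    Unique.++⁺ (colours-fresh Rx) (unique-reverse (colours-fresh Ry))
      (disjoint-by (colours-in Rx) (all-reverse (colours-in Ry)) cDisj)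
    where
    outWalk : Walk G c h y (h ∷ reverse (vertices Ry)) (reverse (colours Ry))
    outWalk = subst (λ vs → Walk G c h y vs _) (reverse-++ (vertices Ry) (h ∷ []))
                (reverse-walk s (walk Ry))
    vExcl : ∀ {z} → z ≢ h × Pv z → z ≡ h ⊎ Pv′ z → ⊥
    vExcl (z≢h , _)  (inj₁ z≡h) = z≢h z≡h
    vExcl (_ , pz)   (inj₂ pz′) = vDisj pz pz′

  descent-walk : (f : ℕ → Fin n) → ∀ i → (∀ {j} → j < i → adj G (f (suc j)) (f j) ≡ true) →
                 Walk G c (f i) (f 0) (applyDownFrom (f ∘ suc) i ∷ʳ f 0)
                                      (applyDownFrom (λ j → c (f (suc j)) (f j)) i)
  descent-walk f zero    edges = here
  descent-walk f (suc i) edges = step (edges ≤-refl) (descent-walk f i (edges ∘ m<n⇒m<1+n))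

  descent-route : (f : ℕ → Fin n) (ℓ : ℕ → ℕ) (i : ℕ) {Pv : Fin n → Set} {Q : ℕ → Set} →
    (∀ {j} → j < i → ColouredEdge (f (suc j)) (f j) (ℓ j)) →
    (∀ {j j′} → j′ < j → j < i → f (suc j) ≢ f (suc j′)) →
    (∀ {j j′} → j′ < j → j < i → ℓ j ≢ ℓ j′) →
    (∀ {j} → j < i → f (suc j) ≢ f 0) →
    (∀ {j} → j < i → Pv (f (suc j))) →
    (∀ {j} → j < i → Q (ℓ j)) →
    Route (f 0) (f i) Pv (Q ∘ toℕ)
  descent-route f ℓ i {Q = Q} edges vInj ℓInj avoid pv q = record
    { vertices       = applyDownFrom (f ∘ suc) i
    ; colours        = applyDownFrom colourAt i
    ; walk           = descent-walk f i (proj₁ ∘ edges)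
    ; vertices-fresh = Unique.applyDownFrom⁺₁ (f ∘ suc) i vInj
    ; colours-fresh  = Unique.applyDownFrom⁺₁ colourAt i
        (λ j′<j j<i eq → ℓInj j′<j j<i
          (trans (sym (proj₂ (edges j<i))) (trans (cong toℕ eq) (proj₂ (edges (<-trans j′<j j<i))))))
    ; avoid-hub      = All.applyDownFrom⁺₁ (f ∘ suc) i avoid
    ; vertices-in    = All.applyDownFrom⁺₁ (f ∘ suc) i pv
    ; colours-in     = All.applyDownFrom⁺₁ colourAt i (λ j<i → subst Q (sym (proj₂ (edges j<i))) (q j<i))
    }
    where
    colourAt : ℕ → Fin k
    colourAt j = c (f (suc j)) (f j)

indicator : Bool → ℕ
indicator b = if b then 1 else 0

indicator≤1 : ∀ b → indicator b ≤ 1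
indicator≤1 true  = ≤-refl
indicator≤1 false = z≤n

indicator-∨ : ∀ a b → indicator (a ∨ b) ≤ indicator a + indicator b
indicator-∨ true  b = s≤s z≤n
indicator-∨ false b = ≤-refl

sumBelow : ℕ → (ℕ → ℕ) → ℕ
sumBelow zero    f = 0
sumBelow (suc n) f = f 0 + sumBelow n (f ∘ suc)

sum-allFin : ∀ n (f : ℕ → ℕ) → sum (map (f ∘ toℕ) (allFin n)) ≡ sumBelow n f
sum-allFin n f = trans (cong sum (map-tabulate {n = n} (λ i → i) (f ∘ toℕ))) (sum-tabulate n f)
  where
  sum-tabulate : ∀ n (f : ℕ → ℕ) → sum (tabulate {n = n} (f ∘ toℕ)) ≡ sumBelow n f
  sum-tabulate zero    f = refl
  sum-tabulate (suc n) f = cong (f 0 +_) (sum-tabulate n (f ∘ suc))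

sumBelow-mono : ∀ n {f g} → (∀ x → f x ≤ g x) → sumBelow n f ≤ sumBelow n g
sumBelow-mono zero    f≤g = z≤n
sumBelow-mono (suc n) f≤g = +-mono-≤ (f≤g 0) (sumBelow-mono n (f≤g ∘ suc))

sumBelow-+ : ∀ n f g → sumBelow n (λ x → f x + g x) ≡ sumBelow n f + sumBelow n g
sumBelow-+ zero    f g = refl
sumBelow-+ (suc n) f g = trans (cong (f 0 + g 0 +_) (sumBelow-+ n (f ∘ suc) (g ∘ suc)))
                               (interchange (f 0) (g 0) _ _)

sumBelow-zero : ∀ n → sumBelow n (λ _ → 0) ≡ 0
sumBelow-zero zero    = refl
sumBelow-zero (suc n) = sumBelow-zero n

count-< : ∀ n c → sumBelow n (λ x → indicator (x <ᵇ c)) ≤ c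
count-< zero    c       = z≤n
count-< (suc n) zero    = count-< n zero
count-< (suc n) (suc c) = s≤s (count-< n c)

count-≮ : ∀ n c → sumBelow n (λ x → indicator (not (x <ᵇ c))) ≤ n ∸ c
count-≮ zero    c       = z≤n
count-≮ (suc n) zero    = s≤s (count-≮ n zero)
count-≮ (suc n) (suc c) = count-≮ n c

count-≡ : ∀ n t → sumBelow n (λ x → indicator (x ≡ᵇ t)) ≤ 1
count-≡ zero    t       = z≤n
count-≡ (suc n) zero    = s≤s (≤-reflexive (sumBelow-zero n))
count-≡ (suc n) (suc t) = count-≡ n t

-- The simple graph on Fin n whose edges are the pairs {x, y} with R x y; R only
-- relates x to larger y, so each edge is recorded exactly once.
module Oriented (n : ℕ) .{{_ : NonZero n}} (R : ℕ → ℕ → Bool)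
                (R⇒< : ∀ {x y} → R x y ≡ true → x < y) where

  R-irrefl : ∀ x → R x x ∨ R x x ≡ false
  R-irrefl x with R x x in eq
  ... | true  = ⊥-elim (<-irrefl refl (R⇒< eq))
  ... | false = refl

  orientedGraph : Graph n
  orientedGraph = record
    { adj    = λ i j → R (toℕ i) (toℕ j) ∨ R (toℕ j) (toℕ i)
    ; sym    = λ i j → ∨-comm (R (toℕ i) (toℕ j)) (R (toℕ j) (toℕ i))
    ; irrefl = R-irrefl ∘ toℕ
    }

  edge-count : numEdges orientedGraph ≤ sumBelow n (λ x → sumBelow n (λ y → indicator (R x y)))
  edge-count = begin
    numEdges orientedGraph ≡⟨ sum-allFin n rowSum ⟩
    sumBelow n rowSum      ≤⟨ sumBelow-mono n rowSum≤ ⟩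
    sumBelow n (λ x → sumBelow n (λ y → indicator (R x y))) ∎
    where
    open ≤-Reasoning
    entry : ℕ → ℕ → ℕ
    entry x y = indicator ((R x y ∨ R y x) ∧ (x <ᵇ y))
    rowSum : ℕ → ℕ
    rowSum x = sum (map (entry x ∘ toℕ) (allFin n))
    entry≤R : ∀ x y → entry x y ≤ indicator (R x y)
    entry≤R x y with R x y | R y x in yx
    ... | true  | _     = indicator≤1 (x <ᵇ y)
    ... | false | false = z≤n
    ... | false | true  = ≤-reflexive (cong indicator (<ᵇ-false (<⇒≤ (R⇒< yx))))
    rowSum≤ : ∀ x → rowSum x ≤ sumBelow n (λ y → indicator (R x y))
    rowSum≤ x = begin
      rowSum x             ≡⟨ sum-allFin n (entry x) ⟩
      sumBelow n (entry x) ≤⟨ sumBelow-mono n (entry≤R x) ⟩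
      sumBelow n (λ y → indicator (R x y)) ∎

  vertex : ℕ → Fin n
  vertex z = z mod n

  orientedColouring : ∀ {k} .{{_ : NonZero k}} → (ℕ → ℕ → ℕ) → EdgeColoring n k
  orientedColouring {k} col i j = col (toℕ i ⊓ toℕ j) (toℕ i ⊔ toℕ j) mod k

  orientedColouring-sym : ∀ {k} .{{_ : NonZero k}} (col : ℕ → ℕ → ℕ) →
                          IsSymmetric {k = k} (orientedColouring col)
  orientedColouring-sym {k} col i j =
    cong₂ (λ a b → col a b mod k) (⊓-comm (toℕ i) (toℕ j)) (⊔-comm (toℕ i) (toℕ j))

  oriented-edge : ∀ {k} .{{_ : NonZero k}} (col : ℕ → ℕ → ℕ) {x y} → x < n → y < n →
                  R x y ≡ true → col x y < k →
                  ColouredEdge {G = orientedGraph} {c = orientedColouring col} (vertex x) (vertex y) (col x y)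
  oriented-edge col {x} {y} x<n y<n Rxy col<k
    rewrite toℕ-mod x<n | toℕ-mod y<n | Rxy
          | m≤n⇒m⊓n≡m (<⇒≤ (R⇒< Rxy)) | m≤n⇒m⊔n≡n (<⇒≤ (R⇒< Rxy)) = refl , toℕ-mod col<k

-- The extremal graph for d = m + 1 colours and n = 1 + q m + r vertices (0 < q,
-- r < m, m ≥ 2): q cycles of length d through a hub, plus r pendant vertices at the
-- hub.  Vertex 0 is the hub, 1 + b + p q (p < m, b < q) is the p-th vertex of the
-- b-th cycle ("level p"), and 1 + m q + t (t < r) is the t-th pendant vertex.  Along
-- each cycle hub, level 0, …, level m₁, hub the edges get the colours 0, 1, …, m; the
-- t-th pendant edge gets colour t.
module Construction (m₁ q r n′ : ℕ) .{{_ : NonZero m₁}} .{{_ : NonZero q}}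
                    (r<m : r < suc m₁) (n′≡ : n′ ≡ r + q * suc m₁) where

  m d N K : ℕ
  m = suc m₁
  d = suc m
  N = suc n′
  K = m₁ * q      -- number of vertices on levels below m₁

  mq≤n′ : m * q ≤ n′
  mq≤n′ = subst (m * q ≤_) (sym n′≡) (subst (_≤ r + q * m) (*-comm q m) (m≤n+m (q * m) r))

  mq+r≡n′ : m * q + r ≡ n′
  mq+r≡n′ = trans (+-comm (m * q) r) (trans (cong (r +_) (*-comm m q)) (sym n′≡))

  q≤K : q ≤ K
  q≤K = m≤n*m q m₁

  -- Edges, oriented from the smaller to the larger endpoint: the hub is joined to
  -- levels 0 and m₁ and to the pendant vertices; every vertex below level m₁ is
  -- joined to the vertex q further on, the next vertex of its cycle.
  R : ℕ → ℕ → Bool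
  R zero    zero    = false
  R zero    (suc y) = (y <ᵇ q) ∨ not (y <ᵇ K)
  R (suc x) y       = (x <ᵇ K) ∧ (y ≡ᵇ suc (x + q))

  R⇒< : ∀ {x y} → R x y ≡ true → x < y
  R⇒< {zero}  {suc y} _ = z<s
  R⇒< {suc x} {y}     e with x <ᵇ K   -- if x <ᵇ K is false, e : false ≡ true is absurd
  ... | true  = subst (suc x <_) (sym (≡ᵇ⇒≡ y _ (subst T (sym e) _))) (s≤s (m<m+n x (>-nonZero⁻¹ q)))

  col : ℕ → ℕ → ℕ
  col zero    zero    = 0
  col zero    (suc y) = if y <ᵇ q then 0 else if y <ᵇ m * q then m else y ∸ m * q
  col (suc x) _       = suc (x / q)

  open Oriented N R R⇒<

  G : Graph N
  G = orientedGraph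

  c : EdgeColoring N d
  c = orientedColouring col

  c-sym : IsSymmetric c
  c-sym = orientedColouring-sym col

  hub : Fin N
  hub = vertex 0

  level : ℕ → ℕ → Fin N
  level p b = vertex (suc (b + p * q))

  pendant : ℕ → Fin N
  pendant t = vertex (suc (m * q + t))

  Edge : Fin N → Fin N → ℕ → Set
  Edge = ColouredEdge {G = G} {c = c}

  HubRoute : Fin N → (Fin N → Set) → (Fin d → Set) → Set
  HubRoute = Route {G = G} {c = c} hub

  level-code< : ∀ {p b} → p < m → b < q → suc (b + p * q) < N
  level-code< {p} {b} p<m b<q = s≤s (<-≤-trans (+-monoˡ-< (p * q) b<q) (≤-trans (*-monoˡ-≤ q p<m) mq≤n′))

  pendant-code< : ∀ {t} → t < r → suc (m * q + t) < N
  pendant-code< t<r = s≤s (subst (_ <_) mq+r≡n′ (+-monoʳ-< (m * q) t<r))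

  toℕ-level : ∀ {p b} → p < m → b < q → toℕ (level p b) ≡ suc (b + p * q)
  toℕ-level p<m b<q = toℕ-mod (level-code< p<m b<q)

  toℕ-pendant : ∀ {t} → t < r → toℕ (pendant t) ≡ suc (m * q + t)
  toℕ-pendant t<r = toℕ-mod (pendant-code< t<r)

  level-injective : ∀ {p b p′ b′} → p < m → b < q → p′ < m → b′ < q →
                    level p b ≡ level p′ b′ → p ≡ p′ × b ≡ b′
  level-injective p<m b<q p′<m b′<q eq = digits-injective b<q b′<q
    (suc-injective (trans (sym (toℕ-level p<m b<q)) (trans (cong toℕ eq) (toℕ-level p′<m b′<q))))

  level≢hub : ∀ {p b} → p < m → b < q → level p b ≢ hub
  level≢hub p<m b<q eq with trans (sym (toℕ-level p<m b<q)) (cong toℕ eq)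
  ... | ()

  pendant≢hub : ∀ {t} → t < r → pendant t ≢ hub
  pendant≢hub t<r eq with trans (sym (toℕ-pendant t<r)) (cong toℕ eq)
  ... | ()

  level≢pendant : ∀ {p b t} → p < m → b < q → t < r → level p b ≢ pendant t
  level≢pendant {p} {b} {t} p<m b<q t<r eq = <⇒≱ (<-≤-trans (+-monoˡ-< (p * q) b<q) (*-monoˡ-≤ q p<m))
    (subst (m * q ≤_)
      (suc-injective (trans (sym (toℕ-pendant t<r)) (trans (cong toℕ (sym eq)) (toℕ-level p<m b<q))))
      (m≤m+n (m * q) t))

  data Shape : Fin N → Set where
    hub′     : Shape hub
    level′   : ∀ {p b} → p < m → b < q → Shape (level p b)
    pendant′ : ∀ {t} → t < r → Shape (pendant t)

  shape : ∀ x → Shape x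
  shape x = subst Shape (toℕ-injective (toℕ-mod (toℕ<n x))) (shape-of (toℕ x) (toℕ<n x))
    where
    shape-of : ∀ z → z < N → Shape (vertex z)
    shape-of zero    _         = hub′
    shape-of (suc z) (s≤s z<n′) with z <? m * q
    ... | yes z<mq = subst (Shape ∘ vertex ∘ suc) (sym (m≡m%n+[m/n]*n z q))
                       (level′ (m<n*o⇒m/o<n z<mq) (m%n<n z q))
    ... | no  z≮mq = subst (Shape ∘ vertex ∘ suc) (m+[n∸m]≡n (≮⇒≥ z≮mq))
                       (pendant′ (+-cancelˡ-< (m * q) _ _
                         (subst₂ _<_ (sym (m+[n∸m]≡n (≮⇒≥ z≮mq))) (sym mq+r≡n′) z<n′)))

  edge : ∀ {x y j} → x < N → y < N → R x y ≡ true → col x y ≡ j → j < d → Edge (vertex x) (vertex y) j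
  edge x<N y<N Rxy refl j<d = oriented-edge col x<N y<N Rxy j<d

  flipped : ∀ u v {j} → Edge u v j → Edge v u j
  flipped u v = flip-edge {G = G} {c = c} c-sym {u} {v}

  reversed-edge : ∀ {x y j} → x < N → y < N → R x y ≡ true → col x y ≡ j → j < d →
                  Edge (vertex y) (vertex x) j
  reversed-edge {x} {y} x<N y<N Rxy col≡j j<d = flipped (vertex x) (vertex y) (edge x<N y<N Rxy col≡j j<d)

  bottom-edge : ∀ {b} → b < q → Edge (level 0 b) hub 0
  bottom-edge {b} b<q =
    reversed-edge z<s (level-code< z<s b<q) (cong (λ t → t ∨ not (b + 0 <ᵇ K)) b<ᵇq)
      (cong (λ t → if t then 0 else (if b + 0 <ᵇ m * q then m else b + 0 ∸ m * q)) b<ᵇq) z<s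
    where
    b<ᵇq : (b + 0 <ᵇ q) ≡ true
    b<ᵇq = <ᵇ-true (subst (_< q) (sym (+-identityʳ b)) b<q)

  rung-edge : ∀ {p b} → suc p < m → b < q → Edge (level p b) (level (suc p) b) (suc p)
  rung-edge {p} {b} sp<m b<q =
    edge (level-code< (<-trans (n<1+n p) sp<m) b<q) (level-code< sp<m b<q)
      (cong₂ _∧_ (<ᵇ-true below-K) (trans (cong (_≡ᵇ b + p * q + q) next) (≡ᵇ-refl (b + p * q + q))))
      (cong suc (div-digits b<q)) (m<n⇒m<1+n sp<m)
    where
    below-K : b + p * q < K
    below-K = <-≤-trans (+-monoˡ-< (p * q) b<q) (*-monoˡ-≤ q (≤-pred sp<m))
    next : b + (q + p * q) ≡ b + p * q + q
    next = trans (cong (b +_) (+-comm q (p * q))) (sym (+-assoc b (p * q) q))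

  top-edge : ∀ {b} → b < q → Edge (level m₁ b) hub m
  top-edge {b} b<q =
    reversed-edge z<s (level-code< (n<1+n m₁) b<q)
      (trans (cong (λ t → (b + K <ᵇ q) ∨ not t) (<ᵇ-false (m≤n+m K b))) (∨-zeroʳ _))
      (trans (cong (λ t → if t then 0 else (if b + K <ᵇ m * q then m else b + K ∸ m * q))
                   (<ᵇ-false (≤-trans q≤K (m≤n+m K b))))
             (cong (λ t → if t then m else b + K ∸ m * q) (<ᵇ-true (+-monoˡ-< K b<q))))
      (n<1+n m)

  pendant-edge : ∀ {t} → t < r → Edge (pendant t) hub t
  pendant-edge {t} t<r =
    reversed-edge z<s (pendant-code< t<r)
      (trans (cong (λ u → (m * q + t <ᵇ q) ∨ not u) (<ᵇ-false (≤-trans (m≤n+m K q) (m≤m+n (m * q) t))))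
             (∨-zeroʳ _))
      (trans (cong (λ u → if u then 0 else (if m * q + t <ᵇ m * q then m else m * q + t ∸ m * q))
                   (<ᵇ-false (≤-trans (m≤m+n q K) (m≤m+n (m * q) t))))
        (trans (cong (λ u → if u then m else m * q + t ∸ m * q) (<ᵇ-false (m≤m+n (m * q) t)))
               (m+n∸m≡n (m * q) t)))
      (<-trans t<r (m<n⇒m<1+n r<m))

  OnCycle : ℕ → ℕ → ℕ → Fin N → Set
  OnCycle b lo hi z = ∃[ p ] lo ≤ p × p ≤ hi × p < m × z ≡ level p b

  upward downward : ℕ → ℕ → Fin N
  upward   b zero    = hub
  upward   b (suc j) = level j b
  downward b zero    = hub
  downward b (suc j) = level (m₁ ∸ j) b

  route-down : ∀ {p b} → p < m → b < q → HubRoute (level p b) (OnCycle b 0 p) ((_≤ p) ∘ toℕ)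
  route-down {p} {b} p<m b<q = descent-route (upward b) id (suc p)
    steps
    (λ j′<j j<sp eq → <⇒≢ j′<j (sym (proj₁ (level-injective (<-≤-trans j<sp p<m) b<q
                                                    (<-trans j′<j (<-≤-trans j<sp p<m)) b<q eq))))
    (λ j′<j _ eq → <⇒≢ j′<j (sym eq))
    (λ j<sp → level≢hub (<-≤-trans j<sp p<m) b<q)
    (λ {j} j<sp → j , z≤n , ≤-pred j<sp , <-≤-trans j<sp p<m , refl)
    ≤-pred
    where
    steps : ∀ {j} → j < suc p → Edge (upward b (suc j)) (upward b j) j
    steps {zero}  _     = bottom-edge b<q
    steps {suc j} sj<sp = flipped (level j b) (level (suc j) b)
                            (rung-edge (≤-<-trans (≤-pred sj<sp) p<m) b<q)

  route-up′ : ∀ {s b} → s ≤ m₁ → b < q →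
              HubRoute (level (m₁ ∸ s) b) (OnCycle b (m₁ ∸ s) m₁) ((m₁ ∸ s <_) ∘ toℕ)
  route-up′ {s} {b} s≤m₁ b<q = descent-route (downward b) (m ∸_) (suc s)
    {Q = m₁ ∸ s <_}
    steps
    (λ {j} {j′} j′<j j<ss eq → <⇒≢ (∸-monoʳ-< j′<j (j≤m₁ j<ss))
                         (proj₁ (level-injective (below-m j) b<q (below-m j′) b<q eq)))
    (λ j′<j j<ss eq → <⇒≢ (∸-monoʳ-< j′<j (m≤n⇒m≤1+n (j≤m₁ j<ss))) eq)
    (λ {j} _ → level≢hub (below-m j) b<q)
    (λ {j} j<ss → m₁ ∸ j , ∸-monoʳ-≤ m₁ (≤-pred j<ss) , m∸n≤m m₁ j , below-m j , refl)
    (λ {j} j<ss → <-≤-trans (s≤s (∸-monoʳ-≤ m₁ (≤-pred j<ss)))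
                            (≤-reflexive (sym (+-∸-assoc 1 (j≤m₁ j<ss)))))
    where
    below-m : ∀ j → m₁ ∸ j < m
    below-m j = s≤s (m∸n≤m m₁ j)
    j≤m₁ : ∀ {j} → j < suc s → j ≤ m₁
    j≤m₁ j<ss = ≤-trans (≤-pred j<ss) s≤m₁
    steps : ∀ {j} → j < suc s → Edge (downward b (suc j)) (downward b j) (m ∸ j)
    steps {zero}  _     = top-edge b<q
    steps {suc j} sj<ss = subst (λ i → Edge (level (m₁ ∸ suc j) b) (level i b) i)
                            (sym (+-∸-assoc 1 (j≤m₁ sj<ss)))
                            (rung-edge (s≤s (≤-trans (≤-reflexive (sym (+-∸-assoc 1 (j≤m₁ sj<ss))))
                                                     (m∸n≤m m₁ j))) b<q)

  route-up : ∀ {p b} → p < m → b < q → HubRoute (level p b) (OnCycle b p m₁) ((p <_) ∘ toℕ)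
  route-up {p} {b} p<m b<q =
    subst (λ p → HubRoute (level p b) (OnCycle b p m₁) ((p <_) ∘ toℕ)) (m∸[m∸n]≡n (≤-pred p<m))
      (route-up′ (m∸n≤m m₁ p) b<q)

  route-pendant : ∀ {t} → t < r → HubRoute (pendant t) (_≡ pendant t) ((_≡ t) ∘ toℕ)
  route-pendant {t} t<r = descent-route ends (λ _ → t) 1 {Q = _≡ t}
    (λ { {zero} _ → pendant-edge t<r ; {suc _} (s≤s ()) })
    (λ { () (s≤s z≤n) })
    (λ { () (s≤s z≤n) })
    (λ { {zero} _ → pendant≢hub t<r ; {suc _} (s≤s ()) })
    (λ { {zero} _ → refl ; {suc _} (s≤s ()) })
    (λ _ → refl)
    where
    ends : ℕ → Fin N
    ends zero    = hub
    ends (suc _) = pendant t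

  RP : Fin N → Fin N → Set
  RP = RainbowPath G c

  on-cycle≢pendant : ∀ {b lo hi t z} → b < q → t < r → OnCycle b lo hi z → z ≢ pendant t
  on-cycle≢pendant b<q t<r (_ , _ , _ , p<m , refl) = level≢pendant p<m b<q t<r

  -- Two cycle vertices, the lower-or-equal level p first: go down from the first and
  -- up to the second; the colours ≤ p and > p′ ≥ p do not meet.
  level-level : ∀ {p b p′ b′} → p < m → b < q → p′ < m → b′ < q → p ≤ p′ →
                level p b ≢ level p′ b′ → RP (level p b) (level p′ b′)
  level-level {p} {b} {p′} {b′} p<m b<q p′<m b′<q p≤p′ ne =
    glue c-sym (route-down p<m b<q) (route-up p′<m b′<q) disjoint-vertices
      (λ a≤p p′<a → <⇒≱ p′<a (≤-trans a≤p p≤p′))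
    where
    disjoint-vertices : ∀ {z} → OnCycle b 0 p z → OnCycle b′ p′ m₁ z → ⊥
    disjoint-vertices (i , _ , i≤p , i<m , refl) (j , p′≤j , _ , j<m , z≡)
      with level-injective i<m b<q j<m b′<q z≡
    ... | refl , refl = ne (cong₂ level (≤-antisym p≤p′ (≤-trans p′≤j i≤p)) refl)

  -- A cycle vertex at level p and the t-th pendant vertex: leave the cycle on the side
  -- whose colours avoid t.
  level-pendant : ∀ {p b t} → p < m → b < q → t < r → RP (level p b) (pendant t)
  level-pendant {p} {t = t} p<m b<q t<r with t ≤? p
  ... | yes t≤p = glue c-sym (route-up p<m b<q) (route-pendant t<r)
                    (on-cycle≢pendant b<q t<r) (λ p<a a≡t → <⇒≱ p<a (≤-trans (≤-reflexive a≡t) t≤p))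
  ... | no  t≰p = glue c-sym (route-down p<m b<q) (route-pendant t<r)
                    (on-cycle≢pendant b<q t<r) (λ a≤p a≡t → t≰p (subst (_≤ p) a≡t a≤p))

  -- Two pendant vertices: their two edges have different colours.
  pendant-pendant : ∀ {t t′} → t < r → t′ < r → pendant t ≢ pendant t′ → RP (pendant t) (pendant t′)
  pendant-pendant t<r t′<r ne = glue c-sym (route-pendant t<r) (route-pendant t′<r)
    (λ z≡t z≡t′ → ne (trans (sym z≡t) z≡t′))
    (λ a≡t a≡t′ → ne (cong pendant (trans (sym a≡t) a≡t′)))

  rainbow-paths : ∀ u v → u ≢ v → RP u v
  rainbow-paths u v u≢v with shape u | shape v
  ... | hub′ | hub′ = ⊥-elim (u≢v refl)
  ... | hub′ | level′ p<m b<q = reverse-path c-sym (route-path (route-down p<m b<q))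
  ... | hub′ | pendant′ t<r = reverse-path c-sym (route-path (route-pendant t<r))
  ... | level′ p<m b<q | hub′ = route-path (route-down p<m b<q)
  ... | pendant′ t<r | hub′ = route-path (route-pendant t<r)
  ... | level′ {p} p<m b<q | level′ {p′} p′<m b′<q with ≤-total p p′
  ...   | inj₁ p≤p′ = level-level p<m b<q p′<m b′<q p≤p′ u≢v
  ...   | inj₂ p′≤p = reverse-path c-sym (level-level p′<m b′<q p<m b<q p′≤p (u≢v ∘ sym))
  rainbow-paths u v u≢v | level′ p<m b<q | pendant′ t<r = level-pendant p<m b<q t<r
  rainbow-paths u v u≢v | pendant′ t<r | level′ p<m b<q = reverse-path c-sym (level-pendant p<m b<q t<r)
  rainbow-paths u v u≢v | pendant′ t<r | pendant′ t′<r = pendant-pendant t<r t′<r u≢v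

  rainbow-connected : RainbowConnected G d
  rainbow-connected = c , c-sym , rainbow-paths

  -- Edge count: the hub has q + (n′ − K) neighbours above it, every other vertex at
  -- most one (exactly the K vertices below level m₁), giving q m + r + q edges.
  hub-degree : sumBelow N (λ y → indicator (R 0 y)) ≤ q + (n′ ∸ K)
  hub-degree = begin
    sumBelow n′ (λ y → indicator ((y <ᵇ q) ∨ not (y <ᵇ K)))
      ≤⟨ sumBelow-mono n′ (λ y → indicator-∨ (y <ᵇ q) (not (y <ᵇ K))) ⟩
    sumBelow n′ (λ y → indicator (y <ᵇ q) + indicator (not (y <ᵇ K)))
      ≡⟨ sumBelow-+ n′ (λ y → indicator (y <ᵇ q)) (λ y → indicator (not (y <ᵇ K))) ⟩
    sumBelow n′ (λ y → indicator (y <ᵇ q)) + sumBelow n′ (λ y → indicator (not (y <ᵇ K)))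
      ≤⟨ +-mono-≤ (count-< n′ q) (count-≮ n′ K) ⟩
    q + (n′ ∸ K) ∎
    where open ≤-Reasoning

  out-degree : ∀ x → sumBelow N (λ y → indicator (R (suc x) y)) ≤ indicator (x <ᵇ K)
  out-degree x with x <ᵇ K
  ... | true  = count-≡ N (suc (x + q))
  ... | false = ≤-reflexive (sumBelow-zero N)

  K≤n′ : K ≤ n′
  K≤n′ = ≤-trans (m≤n+m K q) mq≤n′

  edges≤ : numEdges G ≤ n′ + q
  edges≤ = begin
    numEdges G
      ≤⟨ edge-count ⟩
    sumBelow N (λ y → indicator (R 0 y)) + sumBelow n′ (λ x → sumBelow N (λ y → indicator (R (suc x) y)))
      ≤⟨ +-mono-≤ hub-degree (sumBelow-mono n′ out-degree) ⟩
    q + (n′ ∸ K) + sumBelow n′ (λ x → indicator (x <ᵇ K))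
      ≤⟨ +-monoʳ-≤ (q + (n′ ∸ K)) (count-< n′ K) ⟩
    q + (n′ ∸ K) + K
      ≡⟨ +-assoc q (n′ ∸ K) K ⟩
    q + (n′ ∸ K + K)
      ≡⟨ cong (q +_) (m∸n+n≡m K≤n′) ⟩
    q + n′
      ≡⟨ +-comm q n′ ⟩
    n′ + q ∎
    where open ≤-Reasoning

edge-budget : ∀ m₁ q r n′ .{{_ : NonZero q}} → r < suc m₁ → n′ ≡ r + q * suc m₁ →
              suc n′ ∸ 2 + ceilDiv (suc n′) (suc m₁) ≡ n′ + q
edge-budget m₁ q r n′ r<m n′≡ = begin
  n′ ∸ 1 + (suc n′ + m₁) / m    ≡⟨ cong (λ x → n′ ∸ 1 + x / m) numerator ⟩
  n′ ∸ 1 + (r + suc q * m) / m  ≡⟨ cong (n′ ∸ 1 +_) (div-digits r<m) ⟩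
  n′ ∸ 1 + suc q                ≡⟨ +-suc (n′ ∸ 1) q ⟩
  suc (n′ ∸ 1) + q              ≡⟨ cong (_+ q) (m+[n∸m]≡n 1≤n′) ⟩
  n′ + q                        ∎
  where
  open ≡-Reasoning
  m : ℕ
  m = suc m₁
  numerator : suc n′ + m₁ ≡ r + suc q * m
  numerator = begin
    suc n′ + m₁          ≡⟨ sym (+-suc n′ m₁) ⟩
    n′ + m               ≡⟨ cong (_+ m) n′≡ ⟩
    r + q * m + m        ≡⟨ +-assoc r (q * m) m ⟩
    r + (q * m + m)      ≡⟨ cong (r +_) (+-comm (q * m) m) ⟩
    r + suc q * m        ∎
  1≤n′ : 1 ≤ n′
  1≤n′ = ≤-trans (>-nonZero⁻¹ q)
           (≤-trans (m≤m*n q m) (subst (q * m ≤_) (sym n′≡) (m≤n+m (q * m) r)))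

-- Write d = m + 1 and n = n′ + 1 with n′ = q m + r, r < m.  Since d < ⌈n/2⌉ ≤ n we
-- have m ≤ n′, so q ≥ 1 and the bouquet of the module Construction applies; its edge
-- count n′ + q is the required bound by edge-budget.
proposition3 : (n d : ℕ) → 3 ≤ d → d < ⌈ n /2⌉ →
    Σ (Graph n) (λ G → (numEdges G ≤ n ∸ 2 + ceilDiv n (d ∸ 1)) × RainbowConnected G d)
proposition3 zero    _ _ ()
proposition3 (suc n′) (suc (suc (suc a))) (s≤s (s≤s (s≤s z≤n))) d<⌈n/2⌉ =
  G , subst (numEdges G ≤_) (sym (edge-budget (suc a) q r n′ r<m n′≡)) edges≤ , rainbow-connected
  where
  m q r : ℕ
  m = suc (suc a)
  q = n′ / m
  r = n′ % m
  r<m : r < m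
  r<m = m%n<n n′ m
  n′≡ : n′ ≡ r + q * m
  n′≡ = m≡m%n+[m/n]*n n′ m
  m≤n′ : m ≤ n′
  m≤n′ = <⇒≤ (≤-pred (≤-trans d<⌈n/2⌉ (⌈n/2⌉≤n (suc n′))))
  instance
    q≢0 : NonZero q
    q≢0 = >-nonZero (m≥n⇒m/n>0 m≤n′)
  open Construction (suc a) q r n′ r<m n′≡
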